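{- Let $k\ge2$ be an integer. If $D$ is a directed path of order $n\ge2$ or a directed cycle of order $n$, then $\gamma_{trk}(D)=n$.
   Context: All digraphs are finite, without loops or multiple arcs (pairs of opposite arcs are allowed; a directed cycle has order at least 2). $N^-(v)$ is the set of in-neighbors of $v$. A vertex is isolated if it has no in- or out-neighbors. A $k$RDF on $D$ is a function $f:V(D)\to\mathcal{P}(\{1,\dots,k\})$ such that every $v$ with $f(v)=\emptyset$ satisfies $\bigcup_{u\in N^-(v)}f(u)=\{1,\dots,k\}$; its weight is $\sum_v|f(v)|$. For $D$ with no isolated vertex, a T$k$RDF is a $k$RDF $f$ such that the subdigraph induced by $\{v:f(v)\neq\emptyset\}$ has no isolated vertex; $\gamma_{trk}(D)$ is the minimum weight of a T$k$RDF. -}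

module Defs where

open import Data.Nat using (ℕ; zero; suc; _≤_; _∸_; s≤s)
open import Data.Nat.ListAction using (sum)
open import Data.Fin using (Fin; toℕ)
open import Data.Fin.Subset using (Subset; ∣_∣; _∈_; Empty; Nonempty)
open import Data.List using (List; map; allFin)
open import Data.Product using (Σ; ∃; _×_; _,_)
open import Data.Sum using (_⊎_; inj₁; inj₂)
open import Relation.Nullary using (¬_)
open import Relation.Binary.PropositionalEquality using (_≡_; trans; sym)

record Digraph (n : ℕ) : Set₁ where
  field
    Arc     : Fin n → Fin n → Set
    loopless : ∀ v → ¬ Arc v v
open Digraph public

dirPath : (n : ℕ) → Digraph n
dirPath n = record
  { Arc = λ u v → toℕ v ≡ suc (toℕ u)
  ; loopless = λ v e → lemma (toℕ v) e }
  where
    lemma : ∀ m → ¬ (m ≡ suc m)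
    lemma m ()

cycleLoopless : ∀ n → 2 ≤ n → ∀ (v : Fin n) →
  ¬ ((toℕ v ≡ suc (toℕ v)) ⊎ ((toℕ v ≡ n ∸ 1) × (toℕ v ≡ 0)))
cycleLoopless n h v (inj₁ e) = noSuc (toℕ v) e
  where
    noSuc : ∀ m → ¬ (m ≡ suc m)
    noSuc m ()
cycleLoopless (suc (suc n')) (s≤s (s≤s _)) v (inj₂ (a , b)) with trans (sym b) a
... | ()

dirCycle : (n : ℕ) → 2 ≤ n → Digraph n
dirCycle n h = record
  { Arc = λ u v → (toℕ v ≡ suc (toℕ u)) ⊎ ((toℕ u ≡ n ∸ 1) × (toℕ v ≡ 0))
  ; loopless = cycleLoopless n h }

weight : ∀ {n k} → (Fin n → Subset k) → ℕ
weight {n} f = sum (map (λ v → ∣ f v ∣) (allFin n))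

IsKRDF : ∀ {n} (k : ℕ) (D : Digraph n) → (Fin n → Subset k) → Set
IsKRDF {n} k D f =
  ∀ v → Empty (f v) → ∀ (j : Fin k) → ∃ λ u → Arc D u v × j ∈ f u

IsTKRDF : ∀ {n} (k : ℕ) (D : Digraph n) → (Fin n → Subset k) → Set
IsTKRDF {n} k D f =
  IsKRDF k D f ×
  (∀ v → Nonempty (f v) → ∃ λ u → Nonempty (f u) × (Arc D u v ⊎ Arc D v u))

TotalKRomanDomNumber : ∀ {n} (k : ℕ) (D : Digraph n) → ℕ → Set
TotalKRomanDomNumber {n} k D m =
  (∃ λ (f : Fin n → Subset k) → IsTKRDF k D f × weight f ≡ m) ×
  (∀ (f : Fin n → Subset k) → IsTKRDF k D f → m ≤ weight f)

{-# OPTIONS --safe #-}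
module Submission where

-- Every arc of a directed path or cycle enters v from its cyclic predecessor p v, so for a kRDF f
-- an empty vertex v forces f (p v) to be all of {1,…,k}, of size k ≥ 2. Writing δ₀ for the
-- indicator of 0, this gives 1 + δ₀ ∣f v∣ ≤ ∣f (p v)∣ + δ₀ ∣f (p v)∣ for every v; summing around
-- the cycle the δ₀ terms cancel, so the weight is at least n. Conversely the constant {1} has
-- weight n and is a TkRDF, since no vertex of a path or cycle of order ≥ 2 is isolated.

open import Defs
open import Data.Nat using (ℕ; zero; suc; _+_; _*_; _≤_; _<_; z≤n; s≤s)
open import Data.Nat.Properties
  using (≤-trans; ≤-reflexive; +-assoc; +-comm; +-suc; +-identityʳ; *-identityʳ;
         +-monoʳ-≤; +-cancelʳ-≤; n≮0; suc-injective; module ≤-Reasoning)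
open import Data.Nat.ListAction using (sum)
open import Data.Fin using (Fin; toℕ; inject₁; fromℕ) renaming (zero to fz; suc to fs)
open import Data.Fin.Properties using (toℕ-injective; toℕ-fromℕ; toℕ-inject₁)
open import Data.Fin.Subset using (Subset; ∣_∣; _∈_; Empty; ⁅_⁆; ⊤; _⊆_; _-_)
open import Data.Fin.Subset.Properties using (∣⊤∣≡n; ∣⁅x⁆∣≡1; p⊆q⇒∣p∣≤∣q∣; x∈⁅x⁆; x∈p⇒∣p-x∣<∣p∣)
open import Data.List using (tabulate)
open import Data.List.Properties using (map-tabulate)
open import Data.Product using (∃; _×_; _,_; proj₁)
open import Data.Sum using (_⊎_; inj₁; inj₂; map)
open import Data.Empty using (⊥-elim)
open import Relation.Binary.PropositionalEquality using (_≡_; refl; sym; trans; cong; subst; module ≡-Reasoning)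

Guards : ℕ → ℕ → Set
Guards a b = b ≡ 0 → 2 ≤ a

δ₀ : ℕ → ℕ
δ₀ zero    = 1
δ₀ (suc _) = 0

guards⇒1+δ₀b≤a+δ₀a : ∀ {a b} → Guards a b → 1 + δ₀ b ≤ a + δ₀ a
guards⇒1+δ₀b≤a+δ₀a {a}     {zero}  a≥2 with a≥2 refl
... | s≤s (s≤s _) = s≤s (s≤s z≤n)
guards⇒1+δ₀b≤a+δ₀a {zero}  {suc _} _   = s≤s z≤n
guards⇒1+δ₀b≤a+δ₀a {suc _} {suc _} _   = s≤s z≤n

sum-guardedChain : ∀ m (g : Fin (suc m) → ℕ) →
  (∀ (i : Fin m) → Guards (g (inject₁ i)) (g (fs i))) →
  m + (g (fromℕ m) + δ₀ (g (fromℕ m))) ≤ sum (tabulate g) + δ₀ (g fz)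
sum-guardedChain zero    g _      = ≤-reflexive (cong (_+ δ₀ (g fz)) (sym (+-identityʳ (g fz))))
sum-guardedChain (suc m) g guards = begin
  suc m + (last + δ₀ last)     ≤⟨ s≤s (sum-guardedChain m (λ i → g (fs i)) (λ i → guards (fs i))) ⟩
  suc (rest + δ₀ (g (fs fz)))  ≡⟨ sym (+-suc rest _) ⟩
  rest + (1 + δ₀ (g (fs fz)))  ≤⟨ +-monoʳ-≤ rest (guards⇒1+δ₀b≤a+δ₀a (guards fz)) ⟩
  rest + (g fz + δ₀ (g fz))    ≡⟨ sym (+-assoc rest (g fz) _) ⟩
  (rest + g fz) + δ₀ (g fz)    ≡⟨ cong (_+ δ₀ (g fz)) (+-comm rest (g fz)) ⟩
  (g fz + rest) + δ₀ (g fz)    ∎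
  where
  open ≤-Reasoning
  last = g (fromℕ (suc m))
  rest = sum (tabulate (λ i → g (fs i)))

cyclicPred : ∀ {m} → Fin (suc m) → Fin (suc m)
cyclicPred {m} fz = fromℕ m
cyclicPred (fs i) = inject₁ i

sum-cyclicallyGuarded : ∀ m (g : Fin (suc m) → ℕ) →
  (∀ v → Guards (g (cyclicPred v)) (g v)) → suc m ≤ sum (tabulate g)
sum-cyclicallyGuarded m g guards = +-cancelʳ-≤ (δ₀ (g fz)) (suc m) (sum (tabulate g)) (begin
  suc m + δ₀ (g fz)                     ≡⟨ sym (+-suc m _) ⟩
  m + (1 + δ₀ (g fz))                   ≤⟨ +-monoʳ-≤ m (guards⇒1+δ₀b≤a+δ₀a (guards fz)) ⟩
  m + (g (fromℕ m) + δ₀ (g (fromℕ m)))  ≤⟨ sum-guardedChain m g (λ i → guards (fs i)) ⟩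
  sum (tabulate g) + δ₀ (g fz)          ∎)
  where open ≤-Reasoning

∣p∣≡0⇒Empty : ∀ {k} {p : Subset k} → ∣ p ∣ ≡ 0 → Empty p
∣p∣≡0⇒Empty {p = p} ∣p∣≡0 (x , x∈p) = n≮0 (subst (∣ p - x ∣ <_) ∣p∣≡0 (x∈p⇒∣p-x∣<∣p∣ x∈p))

isKRDF⇒soleInNeighbour-full : ∀ {n k} {D : Digraph n} {f : Fin n → Subset k} {u v} →
  IsKRDF k D f → (∀ {w} → Arc D w v → w ≡ u) → Empty (f v) → ⊤ ⊆ f u
isKRDF⇒soleInNeighbour-full {f = f} krdf sole empty {j} _ with krdf _ empty j
... | w , w→v , j∈fw = subst (λ x → j ∈ f x) (sole w→v) j∈fw

isKRDF⇒cyclicallyGuarded : ∀ {m k} {D : Digraph (suc m)} {f : Fin (suc m) → Subset k} → 2 ≤ k →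
  (∀ {u v} → Arc D u v → u ≡ cyclicPred v) → IsKRDF k D f →
  ∀ v → Guards ∣ f (cyclicPred v) ∣ ∣ f v ∣
isKRDF⇒cyclicallyGuarded {k = k} {D} {f} k≥2 arc⇒pred krdf v ∣fv∣≡0 =
  ≤-trans k≥2 (subst (_≤ ∣ f (cyclicPred v) ∣) (∣⊤∣≡n k)
    (p⊆q⇒∣p∣≤∣q∣ (isKRDF⇒soleInNeighbour-full {D = D} {f} krdf arc⇒pred (∣p∣≡0⇒Empty ∣fv∣≡0))))

weight≡sum-tabulate : ∀ {n k} (f : Fin n → Subset k) → weight f ≡ sum (tabulate (λ v → ∣ f v ∣))
weight≡sum-tabulate f = cong sum (map-tabulate (λ v → v) (λ v → ∣ f v ∣))

isKRDF⇒order≤weight : ∀ {m k} {D : Digraph (suc m)} {f : Fin (suc m) → Subset k} → 2 ≤ k →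
  (∀ {u v} → Arc D u v → u ≡ cyclicPred v) → IsKRDF k D f → suc m ≤ weight f
isKRDF⇒order≤weight {m} {D = D} {f} k≥2 arc⇒pred krdf =
  subst (suc m ≤_) (sym (weight≡sum-tabulate f))
    (sum-cyclicallyGuarded m (λ v → ∣ f v ∣) (isKRDF⇒cyclicallyGuarded {D = D} k≥2 arc⇒pred krdf))

HasNeighbour : ∀ {n} → Digraph n → Fin n → Set
HasNeighbour D v = ∃ λ u → Arc D u v ⊎ Arc D v u

constSingleton-isTKRDF : ∀ {n k} {D : Digraph n} (j : Fin k) →
  (∀ v → HasNeighbour D v) → IsTKRDF k D (λ _ → ⁅ j ⁆)
constSingleton-isTKRDF j neighbour =
  (λ _ empty → ⊥-elim (empty (j , x∈⁅x⁆ j))) ,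
  (λ v _ → let u , arc = neighbour v in u , (j , x∈⁅x⁆ j) , arc)

sum-tabulate-const : ∀ n c → sum (tabulate {n = n} (λ _ → c)) ≡ n * c
sum-tabulate-const zero    c = refl
sum-tabulate-const (suc n) c = cong (c +_) (sum-tabulate-const n c)

weight-constSingleton : ∀ {n k} (j : Fin k) → weight {n} (λ _ → ⁅ j ⁆) ≡ n
weight-constSingleton {n} j = begin
  weight {n} (λ _ → ⁅ j ⁆)                  ≡⟨ weight≡sum-tabulate {n} (λ _ → ⁅ j ⁆) ⟩
  sum (tabulate {n = n} (λ _ → ∣ ⁅ j ⁆ ∣))  ≡⟨ sum-tabulate-const n _ ⟩
  n * ∣ ⁅ j ⁆ ∣                             ≡⟨ cong (n *_) (∣⁅x⁆∣≡1 j) ⟩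
  n * 1                                     ≡⟨ *-identityʳ n ⟩
  n                                         ∎
  where open ≡-Reasoning

γtrk≡order : ∀ {m k} {D : Digraph (suc m)} → 2 ≤ k →
  (∀ {u v} → Arc D u v → u ≡ cyclicPred v) → (∀ v → HasNeighbour D v) →
  TotalKRomanDomNumber k D (suc m)
γtrk≡order {m} {k} {D} k≥2@(s≤s _) arc⇒pred neighbour =
  (_ , constSingleton-isTKRDF {D = D} fz neighbour , weight-constSingleton {suc m} {k} fz) ,
  (λ f tkrdf → isKRDF⇒order≤weight {D = D} {f} k≥2 arc⇒pred (proj₁ tkrdf))

dirPath-arc⇒cyclicPred : ∀ {m} {u v : Fin (suc m)} → Arc (dirPath (suc m)) u v → u ≡ cyclicPred v
dirPath-arc⇒cyclicPred {v = fs i} arc = toℕ-injective (trans (sym (suc-injective arc)) (sym (toℕ-inject₁ i)))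

dirCycle-arc⇒cyclicPred : ∀ {m} (h : 2 ≤ suc m) {u v : Fin (suc m)} → Arc (dirCycle (suc m) h) u v → u ≡ cyclicPred v
dirCycle-arc⇒cyclicPred h (inj₁ arc) = dirPath-arc⇒cyclicPred arc
dirCycle-arc⇒cyclicPred {m} h {v = fz} (inj₂ (toℕu≡m , _)) = toℕ-injective (trans toℕu≡m (sym (toℕ-fromℕ m)))

dirPath-hasNeighbour : ∀ {m} (v : Fin (suc (suc m))) → HasNeighbour (dirPath (suc (suc m))) v
dirPath-hasNeighbour fz     = fs fz , inj₂ refl
dirPath-hasNeighbour (fs i) = inject₁ i , inj₁ (cong suc (sym (toℕ-inject₁ i)))

dirCycle-hasNeighbour : ∀ {m} (h : 2 ≤ suc (suc m)) v → HasNeighbour (dirCycle (suc (suc m)) h) v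
dirCycle-hasNeighbour h v = let u , arc = dirPath-hasNeighbour v in u , map inj₁ inj₁ arc

corollary3p2 : ∀ (k n : ℕ) → 2 ≤ k → (h : 2 ≤ n) →
    TotalKRomanDomNumber k (dirPath n) n × TotalKRomanDomNumber k (dirCycle n h) n
corollary3p2 k (suc (suc m)) k≥2 h@(s≤s (s≤s _)) =
  γtrk≡order {D = dirPath (suc (suc m))} k≥2 dirPath-arc⇒cyclicPred dirPath-hasNeighbour ,
  γtrk≡order {D = dirCycle (suc (suc m)) h} k≥2 (dirCycle-arc⇒cyclicPred h) (dirCycle-hasNeighbour h)
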